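{- There are constants $c,d$ such that for every $n\ge1$ there is a $\mathbf{PC}^=$-proof $\pi_n$ of $\forall\boldsymbol{\lambda}\mathbf I\to(\forall x.\,px=p(qx))\to E_n$ with $\mathrm{cc}(\pi_n)\le c\cdot n+d$.
   Context: Language: a left-associative binary function symbol $\circ$ (application, written as juxtaposition), constants $S,B,C,I,p,q$, equality. $\boldsymbol{\lambda}\mathbf I$ is the set of equations $Sxyz=xz(yz)$, $Bxyz=x(yz)$, $Cxyz=xzy$, $Ix=x$; $\forall\boldsymbol{\lambda}\mathbf I$ is the set of their universal closures, and $\{A_1,\dots,A_m\}\to F$ means $A_1\to\dots\to A_m\to F$. $T:=SB(CBI)$, $T_1:=T$, $T_{n+1}:=T_nT$, $E_n:=\ pq=p(T_nqq)$. $\mathbf{PC}^=$ is the Hilbert-style predicate calculus with equality: initial formulas are propositional tautologies, $\forall xA(x)\to A(t)$ ($\forall^-$), $A(t)\to\exists xA(x)$ ($\exists^+$), and the equality axioms $t=t$, $s=t\to t=s$, $s=t\to t=u\to s=u$, $\vec s=\vec t\to f\vec s=f\vec t$, $\vec s=\vec t\to P\vec s\to P\vec t$; rules are modus ponens, from $A\to B(a)$ infer $A\to\forall xB(x)$, and from $A(a)\to B$ infer $\exists xA(x)\to B$ (eigenvariable $a$ not in the conclusion). The critical count $\mathrm{cc}(\pi)$ is the number of instances of $\forall^-$ and $\exists^+$ in $\pi$. -}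

module Defs where

open import Data.Nat using (ℕ; zero; suc; _+_; _*_; _≤_)
open import Data.Fin using (Fin; zero; suc)
open import Data.Bool using (Bool; true; false; _∧_; _∨_; not)
open import Data.Empty using (⊥)
open import Data.Sum using (_⊎_)
open import Data.List using (List; []; _∷_)
open import Data.List.Membership.Propositional using (_∈_)
open import Relation.Binary.PropositionalEquality using (_≡_)
open import Relation.Nullary using (¬_)

-- Term k : terms with k bound variables in scope (de Bruijn indices,
-- bvar zero = innermost binder) and free variables (eigenvariables)
-- fvar a, a : ℕ.

infixl 9 _·_
data Term (k : ℕ) : Set where
  bvar : Fin k → Term k
  fvar : ℕ → Term k
  S B C I p q : Term k
  _·_ : Term k → Term k → Term k

infix 7 _≐_
infixr 4 _⇒_
data Form (k : ℕ) : Set where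
  _≐_ : Term k → Term k → Form k
  ⊥'  : Form k
  _⇒_ : Form k → Form k → Form k
  _∧'_ : Form k → Form k → Form k
  _∨'_ : Form k → Form k → Form k
  ∀' : Form (suc k) → Form k
  ∃' : Form (suc k) → Form k

-- Closed terms / formulas (no dangling bound variables; free variables allowed).
Term₀ : Set
Term₀ = Term 0

Form₀ : Set
Form₀ = Form 0

wkT : ∀ {k} → Term k → Term (suc k)
wkT (bvar i) = bvar (suc i)
wkT (fvar a) = fvar a
wkT S = S
wkT B = B
wkT C = C
wkT I = I
wkT p = p
wkT q = q
wkT (s · t) = wkT s · wkT t

lift : ∀ {k m} → (Fin k → Term m) → Fin (suc k) → Term (suc m)
lift σ zero = bvar zero
lift σ (suc i) = wkT (σ i)

subT : ∀ {k m} → (Fin k → Term m) → Term k → Term m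
subT σ (bvar i) = σ i
subT σ (fvar a) = fvar a
subT σ S = S
subT σ B = B
subT σ C = C
subT σ I = I
subT σ p = p
subT σ q = q
subT σ (s · t) = subT σ s · subT σ t

subF : ∀ {k m} → (Fin k → Term m) → Form k → Form m
subF σ (s ≐ t) = subT σ s ≐ subT σ t
subF σ ⊥' = ⊥'
subF σ (A ⇒ B') = subF σ A ⇒ subF σ B'
subF σ (A ∧' B') = subF σ A ∧' subF σ B'
subF σ (A ∨' B') = subF σ A ∨' subF σ B'
subF σ (∀' A) = ∀' (subF (lift σ) A)
subF σ (∃' A) = ∃' (subF (lift σ) A)

_[_] : Form 1 → Term₀ → Form₀
A [ t ] = subF (λ _ → t) A

occT : ∀ {k} → ℕ → Term k → Set
occT a (bvar _) = ⊥
occT a (fvar b) = a ≡ b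
occT a S = ⊥
occT a B = ⊥
occT a C = ⊥
occT a I = ⊥
occT a p = ⊥
occT a q = ⊥
occT a (s · t) = occT a s ⊎ occT a t

occF : ∀ {k} → ℕ → Form k → Set
occF a (s ≐ t) = occT a s ⊎ occT a t
occF a ⊥' = ⊥
occF a (A ⇒ B') = occF a A ⊎ occF a B'
occF a (A ∧' B') = occF a A ⊎ occF a B'
occF a (A ∨' B') = occF a A ⊎ occF a B'
occF a (∀' A) = occF a A
occF a (∃' A) = occF a A

⟦_⟧ : Form₀ → (Form₀ → Bool) → Bool
⟦ s ≐ t ⟧ v = v (s ≐ t)
⟦ ⊥' ⟧ v = false
⟦ A ⇒ B' ⟧ v = not (⟦ A ⟧ v) ∨ ⟦ B' ⟧ v
⟦ A ∧' B' ⟧ v = ⟦ A ⟧ v ∧ ⟦ B' ⟧ v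
⟦ A ∨' B' ⟧ v = ⟦ A ⟧ v ∨ ⟦ B' ⟧ v
⟦ ∀' A ⟧ v = v (∀' A)
⟦ ∃' A ⟧ v = v (∃' A)

Taut : Form₀ → Set
Taut A = (v : Form₀ → Bool) → ⟦ A ⟧ v ≡ true

-- A derivation of
-- type Deriv Γ lists its lines newest-first in Γ; each new line is
-- justified (Just Γ A) by an initial formula or a rule applied to
-- earlier lines.

data Just (Γ : List Form₀) : Form₀ → Set where
  taut    : ∀ {A} → Taut A → Just Γ A
  allE    : (A : Form 1) (t : Term₀) → Just Γ (∀' A ⇒ A [ t ])
  exI     : (A : Form 1) (t : Term₀) → Just Γ (A [ t ] ⇒ ∃' A)
  eqRefl  : (t : Term₀) → Just Γ (t ≐ t)
  eqSym   : (s t : Term₀) → Just Γ (s ≐ t ⇒ t ≐ s)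
  eqTrans : (s t u : Term₀) → Just Γ (s ≐ t ⇒ t ≐ u ⇒ s ≐ u)
  -- function congruence (the only function symbol of positive arity is ·;
  -- for the 0-ary constants the axiom is an instance of eqRefl)
  eqApp   : (s₁ s₂ t₁ t₂ : Term₀) →
            Just Γ (s₁ ≐ t₁ ⇒ s₂ ≐ t₂ ⇒ s₁ · s₂ ≐ t₁ · t₂)
  eqPred  : (s₁ s₂ t₁ t₂ : Term₀) →
            Just Γ (s₁ ≐ t₁ ⇒ s₂ ≐ t₂ ⇒ s₁ ≐ s₂ ⇒ t₁ ≐ t₂)
  mp      : ∀ {A B'} → A ∈ Γ → (A ⇒ B') ∈ Γ → Just Γ B'
  genR    : (A : Form₀) (B' : Form 1) (a : ℕ) → (A ⇒ B' [ fvar a ]) ∈ Γ →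
            ¬ occF a A → ¬ occF a (∀' B') → Just Γ (A ⇒ ∀' B')
  exR     : (A : Form 1) (B' : Form₀) (a : ℕ) → (A [ fvar a ] ⇒ B') ∈ Γ →
            ¬ occF a (∃' A) → ¬ occF a B' → Just Γ (∃' A ⇒ B')

data Deriv : List Form₀ → Set where
  []  : Deriv []
  _▷_ : ∀ {Γ A} → Deriv Γ → Just Γ A → Deriv (A ∷ Γ)

record Proof (F : Form₀) : Set where
  constructor proof
  field
    {lines} : List Form₀
    deriv   : Deriv (F ∷ lines)

critical : ∀ {Γ A} → Just Γ A → ℕ
critical (allE _ _) = 1
critical (exI _ _) = 1
critical _ = 0

ccD : ∀ {Γ} → Deriv Γ → ℕ
ccD [] = 0
ccD (d ▷ j) = ccD d + critical j

cc : ∀ {F} → Proof F → ℕ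
cc π = ccD (Proof.deriv π)

-- universal closures of the λI equations (x,y,z bound outermost-first)
private
  x₃ y₃ z₃ : Term 3
  x₃ = bvar (suc (suc zero))
  y₃ = bvar (suc zero)
  z₃ = bvar zero
  x₁ : Term 1
  x₁ = bvar zero

axS axB axC axI : Form₀
axS = ∀' (∀' (∀' (S · x₃ · y₃ · z₃ ≐ x₃ · z₃ · (y₃ · z₃))))
axB = ∀' (∀' (∀' (B · x₃ · y₃ · z₃ ≐ x₃ · (y₃ · z₃))))
axC = ∀' (∀' (∀' (C · x₃ · y₃ · z₃ ≐ x₃ · z₃ · y₃)))
axI = ∀' (I · x₁ ≐ x₁)

_⇛_ : List Form₀ → Form₀ → Form₀
[] ⇛ F = F
(A ∷ As) ⇛ F = A ⇒ (As ⇛ F)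

∀λI : List Form₀
∀λI = axS ∷ axB ∷ axC ∷ axI ∷ []

T : Term₀
T = S · B · (C · B · I)

-- T_n for n ≥ 1 (T_0 is a junk value equal to T, never used)
T_ : ℕ → Term₀
T_ zero = T
T_ (suc zero) = T
T_ (suc (suc n)) = T_ (suc n) · T

E_ : ℕ → Form₀
E_ n = p · q ≐ p · (T_ n · q · q)

hypPQ : Form₀
hypPQ = ∀' (p · x₁ ≐ p · (q · x₁))

Goal : ℕ → Form₀
Goal n = ∀λI ⇛ (hypPQ ⇒ E_ n)

-- Idea: define "levels" of terms.  Level 0 of s is the equation pq = ps;
-- level j+1 of g is the formula Pres j g = ∀x y. (level j of x → y = g x →
-- level j of y), saying that g preserves level j.  Then
--   * base:  q preserves level 0 (one use of the hypothesis on p, q);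
--   * step:  T preserves level j+1 for every j, i.e. if f preserves level j
--            so does T f = λx. f (f x); the proof is uniform in j and uses
--            17 critical instances;
--   * iteration: T_{m+1} preserves level j+1, by induction on m, since
--            T_{m+2} = T_{m+1} T and T has level j+2 (19 instances per round);
--   * conclusion: T_{m+1} maps q (level 1) to a term of level 1, which maps
--            q (level 0) to T_{m+1} q q of level 0, which is E_{m+1}.

module Submission where

open import Defs
open import Data.Nat using (ℕ; _+_; _*_; _≤_)
open import Data.Product using (Σ; _×_; ∃-syntax)
open import Data.Product using (_,_)
open import Data.Nat using (zero; suc)
open import Data.Nat.Properties using (+-assoc; +-identityʳ; ≤-reflexive)
open import Data.Nat.Tactic.RingSolver using (solve-∀)
open import Data.Fin using (Fin; zero; suc)
open import Data.Bool using (Bool; true; false; _∧_; _∨_; not)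
open import Data.Empty using (⊥-elim)
open import Data.Sum using (inj₁; inj₂)
open import Data.List using (List; []; _∷_; _++_)
open import Data.List.Membership.Propositional.Properties using (∈-++⁺ˡ; ∈-++⁺ʳ)
open import Data.List.Relation.Unary.Any using (here)
open import Relation.Binary.PropositionalEquality using (_≡_; _≢_; refl; sym; trans; cong; cong₂; module ≡-Reasoning)
open import Relation.Nullary using (¬_)

-- Leaves are
-- initial formulas (justifications referring to no earlier line); 'cast'
-- rewrites the conclusion along a syntactic identity of formulas.
data Pf : Form₀ → Set where
  initial : ∀ {A} → Just [] A → Pf A
  mpP     : ∀ {A B'} → Pf A → Pf (A ⇒ B') → Pf B'
  genP    : (A : Form₀) (B' : Form 1) (a : ℕ) → Pf (A ⇒ B' [ fvar a ]) →
            ¬ occF a A → ¬ occF a (∀' B') → Pf (A ⇒ ∀' B')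
  cast    : ∀ {A B'} → A ≡ B' → Pf A → Pf B'

ccP : ∀ {A} → Pf A → ℕ
ccP (initial j) = critical j
ccP (mpP h₁ h₂) = ccP h₁ + ccP h₂
ccP (genP _ _ _ h _ _) = ccP h
ccP (cast _ h) = ccP h

weakenJust : ∀ {Γ A} Δ → Just Γ A → Just (Γ ++ Δ) A
weakenJust Δ (taut x) = taut x
weakenJust Δ (allE A t) = allE A t
weakenJust Δ (exI A t) = exI A t
weakenJust Δ (eqRefl t) = eqRefl t
weakenJust Δ (eqSym s t) = eqSym s t
weakenJust Δ (eqTrans s t u) = eqTrans s t u
weakenJust Δ (eqApp s₁ s₂ t₁ t₂) = eqApp s₁ s₂ t₁ t₂
weakenJust Δ (eqPred s₁ s₂ t₁ t₂) = eqPred s₁ s₂ t₁ t₂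
weakenJust Δ (mp x y) = mp (∈-++⁺ˡ x) (∈-++⁺ˡ y)
weakenJust Δ (genR A B' a x n₁ n₂) = genR A B' a (∈-++⁺ˡ x) n₁ n₂
weakenJust Δ (exR A B' a x n₁ n₂) = exR A B' a (∈-++⁺ˡ x) n₁ n₂

critical-weakenJust : ∀ {Γ A} Δ (j : Just Γ A) → critical (weakenJust Δ j) ≡ critical j
critical-weakenJust Δ (taut x) = refl
critical-weakenJust Δ (allE A t) = refl
critical-weakenJust Δ (exI A t) = refl
critical-weakenJust Δ (eqRefl t) = refl
critical-weakenJust Δ (eqSym s t) = refl
critical-weakenJust Δ (eqTrans s t u) = refl
critical-weakenJust Δ (eqApp s₁ s₂ t₁ t₂) = refl
critical-weakenJust Δ (eqPred s₁ s₂ t₁ t₂) = refl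
critical-weakenJust Δ (mp x y) = refl
critical-weakenJust Δ (genR A B' a x n₁ n₂) = refl
critical-weakenJust Δ (exR A B' a x n₁ n₂) = refl

_⨟_ : ∀ {Γ₁ Γ₂} → Deriv Γ₁ → Deriv Γ₂ → Deriv (Γ₂ ++ Γ₁)
d₁ ⨟ [] = d₁
_⨟_ {Γ₁} d₁ (d₂ ▷ j) = (d₁ ⨟ d₂) ▷ weakenJust Γ₁ j

ccD-⨟ : ∀ {Γ₁ Γ₂} (d₁ : Deriv Γ₁) (d₂ : Deriv Γ₂) → ccD (d₁ ⨟ d₂) ≡ ccD d₁ + ccD d₂
ccD-⨟ d₁ [] = sym (+-identityʳ (ccD d₁))
ccD-⨟ {Γ₁} d₁ (d₂ ▷ j) = begin
  ccD (d₁ ⨟ d₂) + critical (weakenJust Γ₁ j)  ≡⟨ cong₂ _+_ (ccD-⨟ d₁ d₂) (critical-weakenJust Γ₁ j) ⟩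
  ccD d₁ + ccD d₂ + critical j                ≡⟨ +-assoc (ccD d₁) (ccD d₂) (critical j) ⟩
  ccD d₁ + (ccD d₂ + critical j)              ∎
  where open ≡-Reasoning

compile : ∀ {F} (h : Pf F) → Σ (Proof F) (λ π → cc π ≡ ccP h)
compile (initial j) = proof ([] ▷ j) , refl
compile (mpP {A} {B'} h₁ h₂) with compile h₁ | compile h₂
... | proof d₁ , e₁ | proof {l₂} d₂ , e₂ =
  proof ((d₁ ⨟ d₂) ▷ mp (∈-++⁺ʳ ((A ⇒ B') ∷ l₂) (here refl)) (here refl)) ,
  trans (+-identityʳ _) (trans (ccD-⨟ d₁ d₂) (cong₂ _+_ e₁ e₂))
compile (genP A B' a h n₁ n₂) with compile h
... | proof d , e = proof (d ▷ genR A B' a (here refl) n₁ n₂) , trans (+-identityʳ _) e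
compile (cast refl h) = compile h

-- Reasoning under a hypothesis formula G (all rules below are free of
-- critical instances except 'instG')

weaken : ∀ {A} G → Pf A → Pf (G ⇒ A)
weaken {A} G h = mpP h (initial (taut (λ v → K (⟦ A ⟧ v) (⟦ G ⟧ v))))
  where
  K : ∀ a g → not a ∨ (not g ∨ a) ≡ true
  K false g = refl
  K true false = refl
  K true true = refl

mpG : ∀ {G A B'} → Pf (G ⇒ A) → Pf (G ⇒ (A ⇒ B')) → Pf (G ⇒ B')
mpG {G} {A} {B'} h₁ h₂ = mpP h₂ (mpP h₁ (initial (taut (λ v → MP (⟦ G ⟧ v) (⟦ A ⟧ v) (⟦ B' ⟧ v)))))
  where
  MP : ∀ g a b → not (not g ∨ a) ∨ (not (not g ∨ (not a ∨ b)) ∨ (not g ∨ b)) ≡ true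
  MP false a b = refl
  MP true false b = refl
  MP true true false = refl
  MP true true true = refl

assume : ∀ G A → Pf ((G ∧' A) ⇒ A)
assume G A = initial (taut (λ v → proj (⟦ G ⟧ v) (⟦ A ⟧ v)))
  where
  proj : ∀ g a → not (g ∧ a) ∨ a ≡ true
  proj false a = refl
  proj true false = refl
  proj true true = refl

extend : ∀ {G X} A → Pf (G ⇒ X) → Pf ((G ∧' A) ⇒ X)
extend {G} {X} A h = mpP h (initial (taut (λ v → mono (⟦ G ⟧ v) (⟦ A ⟧ v) (⟦ X ⟧ v))))
  where
  mono : ∀ g a x → not (not g ∨ x) ∨ (not (g ∧ a) ∨ x) ≡ true
  mono false a x = refl
  mono true false false = refl
  mono true false true = refl
  mono true true false = refl
  mono true true true = refl

deduce : ∀ {G A B'} → Pf ((G ∧' A) ⇒ B') → Pf (G ⇒ (A ⇒ B'))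
deduce {G} {A} {B'} h = mpP h (initial (taut (λ v → curry (⟦ G ⟧ v) (⟦ A ⟧ v) (⟦ B' ⟧ v))))
  where
  curry : ∀ g a b → not (not (g ∧ a) ∨ b) ∨ (not g ∨ (not a ∨ b)) ≡ true
  curry false a b = refl
  curry true false b = refl
  curry true true false = refl
  curry true true true = refl

_&_ : Form₀ → List Form₀ → Form₀
G & [] = G
G & (A ∷ As) = (G ∧' A) & As

discharge : ∀ {G F} As → Pf ((G & As) ⇒ F) → Pf (G ⇒ (As ⇛ F))
discharge [] h = h
discharge (A ∷ As) h = deduce (discharge As h)

⊤' : Form₀
⊤' = ⊥' ⇒ ⊥'

closeTop : ∀ {F} → Pf (⊤' ⇒ F) → Pf F
closeTop h = mpP (initial (taut (λ _ → refl))) h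

instG : ∀ {G A} → Pf (G ⇒ ∀' A) → (t : Term₀) → Pf (G ⇒ A [ t ])
instG {G} {A} h t = mpG h (weaken G (initial (allE A t)))

reflG : ∀ G t → Pf (G ⇒ t ≐ t)
reflG G t = weaken G (initial (eqRefl t))

symG : ∀ {G s t} → Pf (G ⇒ s ≐ t) → Pf (G ⇒ t ≐ s)
symG {G} {s} {t} h = mpG h (weaken G (initial (eqSym s t)))

transG : ∀ {G s t u} → Pf (G ⇒ s ≐ t) → Pf (G ⇒ t ≐ u) → Pf (G ⇒ s ≐ u)
transG {G} {s} {t} {u} h₁ h₂ = mpG h₂ (mpG h₁ (weaken G (initial (eqTrans s t u))))

appG : ∀ {G s₁ s₂ t₁ t₂} → Pf (G ⇒ s₁ ≐ t₁) → Pf (G ⇒ s₂ ≐ t₂) → Pf (G ⇒ s₁ · s₂ ≐ t₁ · t₂)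
appG {G} {s₁} {s₂} {t₁} {t₂} h₁ h₂ = mpG h₂ (mpG h₁ (weaken G (initial (eqApp s₁ s₂ t₁ t₂))))

appˡG : ∀ {G s t} u → Pf (G ⇒ s ≐ t) → Pf (G ⇒ s · u ≐ t · u)
appˡG u h = appG h (reflG _ u)

appʳG : ∀ {G s t} u → Pf (G ⇒ s ≐ t) → Pf (G ⇒ u · s ≐ u · t)
appʳG u h = appG (reflG _ u) h

wkT-subT : ∀ {k m} (σ : Fin k → Term m) t → subT (lift σ) (wkT t) ≡ wkT (subT σ t)
wkT-subT σ (bvar i) = refl
wkT-subT σ (fvar a) = refl
wkT-subT σ S = refl
wkT-subT σ B = refl
wkT-subT σ C = refl
wkT-subT σ I = refl
wkT-subT σ p = refl
wkT-subT σ q = refl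
wkT-subT σ (s · t) = cong₂ _·_ (wkT-subT σ s) (wkT-subT σ t)

subT-wkT : (σ : Fin 1 → Term₀) (t : Term₀) → subT σ (wkT t) ≡ t
subT-wkT σ (bvar ())
subT-wkT σ (fvar a) = refl
subT-wkT σ S = refl
subT-wkT σ B = refl
subT-wkT σ C = refl
subT-wkT σ I = refl
subT-wkT σ p = refl
subT-wkT σ q = refl
subT-wkT σ (s · t) = cong₂ _·_ (subT-wkT σ s) (subT-wkT σ t)

occT-wkT : ∀ {k} a (t : Term k) → occT a (wkT t) → occT a t
occT-wkT a (fvar b) x = x
occT-wkT a (s · t) (inj₁ x) = inj₁ (occT-wkT a s x)
occT-wkT a (s · t) (inj₂ x) = inj₂ (occT-wkT a t x)

shape-≡ : ∀ {k} {X X' W W' : Form k} {u Y Y' : Term k} → X ≡ X' → Y ≡ Y' → W ≡ W' →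
          (X ⇒ (u ≐ Y ⇒ W)) ≡ (X' ⇒ (u ≐ Y' ⇒ W'))
shape-≡ refl refl refl = refl

v₀ : ∀ {k} → Term (suc k)
v₀ = bvar zero

v₁ : ∀ {k} → Term (suc (suc k))
v₁ = bvar (suc zero)

mutual
  Lv : ∀ {k} → ℕ → Term k → Form k
  Lv zero s = p · q ≐ p · s
  Lv (suc j) s = Pres j s

  Pres : ∀ {k} → ℕ → Term k → Form k
  Pres j g = ∀' (∀' (PresBody j g))

  PresBody : ∀ {k} → ℕ → Term k → Form (suc (suc k))
  PresBody j g = Lv j v₁ ⇒ (v₀ ≐ wkT (wkT g) · v₁ ⇒ Lv j v₀)

mutual
  subF-Lv : ∀ {k m} j (σ : Fin k → Term m) s → subF σ (Lv j s) ≡ Lv j (subT σ s)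
  subF-Lv zero σ s = refl
  subF-Lv (suc j) σ s = subF-Pres j σ s

  subF-Pres : ∀ {k m} j (σ : Fin k → Term m) g → subF σ (Pres j g) ≡ Pres j (subT σ g)
  subF-Pres j σ g = cong (λ X → ∀' (∀' X))
    (shape-≡ (subF-Lv j (lift (lift σ)) v₁)
             (cong (_· v₁) (trans (wkT-subT (lift σ) (wkT g)) (cong wkT (wkT-subT σ g))))
             (subF-Lv j (lift (lift σ)) v₀))

mutual
  occF-Lv : ∀ {k} j (s : Term k) a → occF a (Lv j s) → occT a s
  occF-Lv zero s a (inj₁ (inj₁ ()))
  occF-Lv zero s a (inj₁ (inj₂ ()))
  occF-Lv zero s a (inj₂ (inj₁ ()))
  occF-Lv zero s a (inj₂ (inj₂ x)) = x
  occF-Lv (suc j) s a x = occF-Pres j s a x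

  occF-Pres : ∀ {k} j (g : Term k) a → occF a (Pres j g) → occT a g
  occF-Pres j g a (inj₁ x) = ⊥-elim (occF-Lv j v₁ a x)
  occF-Pres j g a (inj₂ (inj₁ (inj₁ ())))
  occF-Pres j g a (inj₂ (inj₁ (inj₂ (inj₁ x)))) = occT-wkT a g (occT-wkT a (wkT g) x)
  occF-Pres j g a (inj₂ (inj₁ (inj₂ (inj₂ ()))))
  occF-Pres j g a (inj₂ (inj₂ x)) = ⊥-elim (occF-Lv j v₀ a x)

PresBody₁ : ℕ → Term₀ → Term₀ → Form 1
PresBody₁ j g t = Lv j (wkT t) ⇒ (v₀ ≐ wkT g · wkT t ⇒ Lv j v₀)

inst-outer : ∀ j g t → subF (lift (λ _ → t)) (PresBody j g) ≡ PresBody₁ j g t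
inst-outer j g t = shape-≡ (subF-Lv j (lift (λ _ → t)) v₁)
  (cong (_· wkT t) (trans (wkT-subT (λ (_ : Fin 1) → t) (wkT g)) (cong wkT (subT-wkT (λ _ → t) g))))
  (subF-Lv j (lift (λ _ → t)) v₀)

inst-inner : ∀ j g t u → PresBody₁ j g t [ u ] ≡ (Lv j t ⇒ (u ≐ g · t ⇒ Lv j u))
inst-inner j g t u = shape-≡ (trans (subF-Lv j (λ _ → u) (wkT t)) (cong (Lv j) (subT-wkT (λ _ → u) t)))
  (cong₂ _·_ (subT-wkT (λ _ → u) g) (subT-wkT (λ _ → u) t))
  (subF-Lv j (λ _ → u) v₀)

usePres : ∀ {G} j g → Pf (G ⇒ Pres j g) → (t u : Term₀) → Pf (G ⇒ (Lv j t ⇒ (u ≐ g · t ⇒ Lv j u)))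
usePres {G} j g h t u =
  cast (cong (G ⇒_) (inst-inner j g t u))
    (instG (cast (cong (λ X → G ⇒ ∀' X) (inst-outer j g t)) (instG h t)) u)

provePres : ∀ G j g c e → ¬ occF c G → ¬ occF e G → e ≢ c → ¬ occT e g → ¬ occT c g →
            Pf (G ⇒ (Lv j (fvar c) ⇒ (fvar e ≐ g · fvar c ⇒ Lv j (fvar e)))) → Pf (G ⇒ Pres j g)
provePres G j g c e c∉G e∉G e≢c e∉g c∉g h =
  genP G (∀' (PresBody j g)) c
    (cast (cong (λ X → G ⇒ ∀' X) (sym (inst-outer j g (fvar c))))
      (genP G (PresBody₁ j g (fvar c)) e (cast (cong (G ⇒_) (sym (inst-inner j g (fvar c) (fvar e)))) h)
        e∉G e∉inner))
    c∉G (λ x → c∉g (occF-Pres j g c x))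
  where
  e∉inner : ¬ occF e (∀' (PresBody₁ j g (fvar c)))
  e∉inner (inj₁ x) = e≢c (occF-Lv j (fvar c) e x)
  e∉inner (inj₂ (inj₁ (inj₁ ())))
  e∉inner (inj₂ (inj₁ (inj₂ (inj₁ x)))) = e∉g (occT-wkT e g x)
  e∉inner (inj₂ (inj₁ (inj₂ (inj₂ x)))) = e≢c x
  e∉inner (inj₂ (inj₂ x)) = occF-Lv j v₀ e x

closedT : ∀ {k} → Term k → Bool
closedT (fvar _) = false
closedT (s · t) = closedT s ∧ closedT t
closedT _ = true

closedF : ∀ {k} → Form k → Bool
closedF (s ≐ t) = closedT s ∧ closedT t
closedF ⊥' = true
closedF (A ⇒ B') = closedF A ∧ closedF B'
closedF (A ∧' B') = closedF A ∧ closedF B'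
closedF (A ∨' B') = closedF A ∧ closedF B'
closedF (∀' A) = closedF A
closedF (∃' A) = closedF A

∧-true-l : ∀ {a b} → a ∧ b ≡ true → a ≡ true
∧-true-l {true} e = refl

∧-true-r : ∀ {a b} → a ∧ b ≡ true → b ≡ true
∧-true-r {true} e = e

closedT-fresh : ∀ {k} (t : Term k) a → closedT t ≡ true → ¬ occT a t
closedT-fresh (fvar _) a () x
closedT-fresh (s · t) a e (inj₁ x) = closedT-fresh s a (∧-true-l e) x
closedT-fresh (s · t) a e (inj₂ x) = closedT-fresh t a (∧-true-r {closedT s} e) x

closedF-fresh : ∀ {k} (A : Form k) a → closedF A ≡ true → ¬ occF a A
closedF-fresh (s ≐ t) a e (inj₁ x) = closedT-fresh s a (∧-true-l e) x
closedF-fresh (s ≐ t) a e (inj₂ x) = closedT-fresh t a (∧-true-r {closedT s} e) x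
closedF-fresh (A ⇒ B') a e (inj₁ x) = closedF-fresh A a (∧-true-l e) x
closedF-fresh (A ⇒ B') a e (inj₂ x) = closedF-fresh B' a (∧-true-r {closedF A} e) x
closedF-fresh (A ∧' B') a e (inj₁ x) = closedF-fresh A a (∧-true-l e) x
closedF-fresh (A ∧' B') a e (inj₂ x) = closedF-fresh B' a (∧-true-r {closedF A} e) x
closedF-fresh (A ∨' B') a e (inj₁ x) = closedF-fresh A a (∧-true-l e) x
closedF-fresh (A ∨' B') a e (inj₂ x) = closedF-fresh B' a (∧-true-r {closedF A} e) x
closedF-fresh (∀' A) a e x = closedF-fresh A a e x
closedF-fresh (∃' A) a e x = closedF-fresh A a e x

Hyps : Form₀
Hyps = ⊤' & (∀λI ++ hypPQ ∷ [])

Hyps-closed : ∀ a → ¬ occF a Hyps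
Hyps-closed a = closedF-fresh Hyps a refl

hypS : Pf (Hyps ⇒ axS)
hypS = extend _ (extend _ (extend _ (extend _ (assume _ _))))

hypB : Pf (Hyps ⇒ axB)
hypB = extend _ (extend _ (extend _ (assume _ _)))

hypC : Pf (Hyps ⇒ axC)
hypC = extend _ (extend _ (assume _ _))

hypI : Pf (Hyps ⇒ axI)
hypI = extend _ (assume _ _)

hypP : Pf (Hyps ⇒ hypPQ)
hypP = assume _ _

a₀ a₁ a₂ a₃ : Term₀
a₀ = fvar 0
a₁ = fvar 1
a₂ = fvar 2
a₃ = fvar 3

-- Base: q preserves level 0 (pq = px and y = qx give pq = px = p(qx) = py).

preservesQ : Pf (Hyps ⇒ Pres 0 q)
preservesQ = provePres Hyps 0 q 0 1 (Hyps-closed 0) (Hyps-closed 1) (λ ()) (λ ()) (λ ())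
  (discharge (Lv 0 a₀ ∷ (a₁ ≐ q · a₀) ∷ []) pq=pa₁)
  where
  Γ₁ Γ : Form₀
  Γ₁ = Hyps ∧' Lv 0 a₀
  Γ = Γ₁ ∧' (a₁ ≐ q · a₀)

  pq=pa₁ : Pf (Γ ⇒ p · q ≐ p · a₁)
  pq=pa₁ = transG (extend _ (assume Hyps _))
             (transG (instG (extend _ (extend _ hypP)) a₀)
               (appʳG p (symG (assume Γ₁ _))))

-- Step: T preserves level j+1.  For f preserving level j and x of level j,
-- T f x = f (f x) by the combinator axioms, so two uses of f give level j.

module Step (j : ℕ) where
  Γ₁ Γ₂ Γ : Form₀
  Γ₁ = Hyps ∧' Pres j a₀
  Γ₂ = Γ₁ ∧' (a₁ ≐ T · a₀)
  Γ = Γ₂ & (Lv j a₂ ∷ (a₃ ≐ a₁ · a₂) ∷ [])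

  -- Γ: f := a₀ preserves level j, a₁ = T f, x := a₂ has level j, y := a₃ = a₁ x.
  fromHyps : ∀ {X} → Pf (Hyps ⇒ X) → Pf (Γ ⇒ X)
  fromHyps h = extend _ (extend _ (extend _ (extend _ h)))

  f-preserves : Pf (Γ ⇒ Pres j a₀)
  f-preserves = extend _ (extend _ (extend _ (assume Hyps _)))

  CBI : Term₀
  CBI = C · B · I

  S-inst : Pf (Γ ⇒ S · B · CBI · a₀ ≐ B · a₀ · (CBI · a₀))
  S-inst = instG (instG (instG (fromHyps hypS) B) CBI) a₀

  B-inst₁ : Pf (Γ ⇒ B · a₀ · (CBI · a₀) · a₂ ≐ a₀ · (CBI · a₀ · a₂))
  B-inst₁ = instG (instG (instG (fromHyps hypB) a₀) (CBI · a₀)) a₂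

  C-inst : Pf (Γ ⇒ C · B · I · a₀ ≐ B · a₀ · I)
  C-inst = instG (instG (instG (fromHyps hypC) B) I) a₀

  B-inst₂ : Pf (Γ ⇒ B · a₀ · I · a₂ ≐ a₀ · (I · a₂))
  B-inst₂ = instG (instG (instG (fromHyps hypB) a₀) I) a₂

  I-inst : Pf (Γ ⇒ I · a₂ ≐ a₂)
  I-inst = instG (fromHyps hypI) a₂

  -- C B I f x = B f I x = f (I x) = f x
  CBI-apply : Pf (Γ ⇒ CBI · a₀ · a₂ ≐ a₀ · a₂)
  CBI-apply = transG (appˡG a₂ C-inst) (transG B-inst₂ (appʳG a₀ I-inst))

  -- y = T f x = S B (CBI) f x = B f (CBI f) x = f (CBI f x) = f (f x)
  T-apply : Pf (Γ ⇒ a₃ ≐ a₀ · (a₀ · a₂))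
  T-apply = transG (assume _ _)
             (transG (appˡG a₂ (extend _ (extend _ (assume Γ₁ _))))
               (transG (appˡG a₂ S-inst) (transG B-inst₁ (appʳG a₀ CBI-apply))))

  level-fx : Pf (Γ ⇒ Lv j (a₀ · a₂))
  level-fx = mpG (reflG _ _) (mpG (extend _ (assume Γ₂ _)) (usePres j a₀ f-preserves a₂ (a₀ · a₂)))

  level-y : Pf (Γ ⇒ Lv j a₃)
  level-y = mpG T-apply (mpG level-fx (usePres j a₀ f-preserves (a₀ · a₂) a₃))

  fresh-Γ₂ : ∀ a → a ≢ 0 → a ≢ 1 → ¬ occF a Γ₂
  fresh-Γ₂ a a≢0 a≢1 (inj₁ (inj₁ x)) = Hyps-closed a x
  fresh-Γ₂ a a≢0 a≢1 (inj₁ (inj₂ x)) = a≢0 (occF-Pres j a₀ a x)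
  fresh-Γ₂ a a≢0 a≢1 (inj₂ (inj₁ x)) = a≢1 x
  fresh-Γ₂ a a≢0 a≢1 (inj₂ (inj₂ (inj₁ x))) = closedT-fresh T a refl x
  fresh-Γ₂ a a≢0 a≢1 (inj₂ (inj₂ (inj₂ x))) = a≢0 x

  Tf-preserves : Pf (Γ₂ ⇒ Pres j a₁)
  Tf-preserves = provePres Γ₂ j a₁ 2 3 (fresh-Γ₂ 2 (λ ()) (λ ())) (fresh-Γ₂ 3 (λ ()) (λ ()))
                   (λ ()) (λ ()) (λ ()) (discharge (Lv j a₂ ∷ (a₃ ≐ a₁ · a₂) ∷ []) level-y)

  preservesT : Pf (Hyps ⇒ Pres (suc j) T)
  preservesT = provePres Hyps (suc j) T 0 1 (Hyps-closed 0) (Hyps-closed 1) (λ ())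
                 (closedT-fresh T 1 refl) (closedT-fresh T 0 refl)
                 (discharge (Pres j a₀ ∷ (a₁ ≐ T · a₀) ∷ []) Tf-preserves)

open Step using (preservesT)

cc-preservesT : ∀ j → ccP (preservesT j) ≡ 17
cc-preservesT j = refl

-- Iteration: T_{m+1} preserves level j+1, since T_{m+2} = T_{m+1} T and
-- T is of level j+2.

preservesTₙ : (m j : ℕ) → Pf (Hyps ⇒ Pres (suc j) (T_ (suc m)))
preservesTₙ zero j = preservesT j
preservesTₙ (suc m) j =
  mpG (reflG _ _) (mpG (preservesT j) (usePres (suc (suc j)) (T_ (suc m)) (preservesTₙ m (suc j)) T (T_ (suc m) · T)))

-- Each round costs the 17 instances of the step plus 2 for applying T_{m+1}.
cc-preservesTₙ : ∀ m j → ccP (preservesTₙ m j) ≡ 19 * m + 17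
cc-preservesTₙ zero j = cc-preservesT j
cc-preservesTₙ (suc m) j rewrite cc-preservesTₙ m (suc j) = arith m
  where
  arith : ∀ m → 2 + (19 * m + 17 + 0 + 0 + 17 + 0) ≡ 19 * suc m + 17
  arith = solve-∀

E-derivation : (m : ℕ) → Pf (Goal (suc m))
E-derivation m = closeTop (discharge (∀λI ++ hypPQ ∷ []) (mpG (reflG _ _) (mpG (reflG _ _) level₀)))
  where
  level₁ : Pf (Hyps ⇒ Pres 0 (T_ (suc m) · q))
  level₁ = mpG (reflG _ _) (mpG preservesQ (usePres 1 (T_ (suc m)) (preservesTₙ m 0) q (T_ (suc m) · q)))

  level₀ : Pf (Hyps ⇒ (Lv 0 q ⇒ (T_ (suc m) · q · q ≐ T_ (suc m) · q · q ⇒ E_ (suc m))))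
  level₀ = usePres 0 (T_ (suc m) · q) level₁ q (T_ (suc m) · q · q)

-- 19 (m+1) - 2 instances for the iteration, 1 for the base, 4 for the conclusion.
cc-E-derivation : ∀ m → ccP (E-derivation m) ≡ 19 * suc m + 3
cc-E-derivation m rewrite cc-preservesTₙ m 0 = arith m
  where
  arith : ∀ m → 2 + ((2 + ((19 * m + 17) + 0 + 0) + (1 + 0) + 0) + 0 + 0) + 0 + 0 + 0 + 0 + 0 + 0 + 0
                ≡ 19 * suc m + 3
  arith = solve-∀

mainTheorem5 : ∃[ c ] ∃[ d ] ((n : ℕ) → 1 ≤ n → Σ (Proof (Goal n)) (λ π → cc π ≤ c * n + d))
mainTheorem5 = 19 , 3 , proofs
  where
  proofs : (n : ℕ) → 1 ≤ n → Σ (Proof (Goal n)) (λ π → cc π ≤ 19 * n + 3)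
  proofs (suc m) _ = let π , cc-π = compile (E-derivation m) in
    π , ≤-reflexive (trans cc-π (cc-E-derivation m))
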